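{- Let $\mathcal D$ be a non-trivial $2$-$(p^d,k,2)$ design ($p$ prime) with even replication number $r$, whose point set is identified with $GF(p^d)$, and suppose $\mathcal D$ admits $G=AGL_1(p^d)=\{x\mapsto ax+c: a\in GF(p^d)^{*}, c\in GF(p^d)\}$ (in this natural action) as a flag-transitive automorphism group. Then $p^{d}\equiv 1\pmod{3}$ and $\mathcal D$ is the design with $k=3$ whose blocks are the sets $\{c+a,\;c+a\zeta,\;c+a\zeta^{2}\}$ for $a\in GF(p^d)^{*}$, $c\in GF(p^d)$, where $\zeta\in GF(p^d)$ is an element of multiplicative order $3$.
   Context: A $2$-$(v,k,2)$ design has $v$ points and blocks of size $k$ such that any two distinct points lie in exactly $2$ blocks; non-trivial means $2<k<v$; the replication number $r$ is the number of blocks through a point. Flag-transitive means transitive on incident point–block pairs. -}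

module Defs where

open import Level using (0ℓ)
open import Data.Nat using (ℕ; zero; suc)
open import Data.Fin using (Fin)
open import Data.Fin.Subset using (Subset; _∈_; ∣_∣)
open import Data.Vec using (tabulate)
open import Data.Bool using (Bool; _∧_)
open import Data.Product using (Σ; ∃; _×_; _,_)
open import Data.Sum using (_⊎_)
open import Function.Bundles using (_↔_; Inverse)
open import Relation.Nullary using (¬_; does)
open import Relation.Binary.PropositionalEquality using (_≡_)
open import Algebra.Bundles using (CommutativeRing)

record FiniteField (q : ℕ) : Set₁ where
  field
    commRing : CommutativeRing 0ℓ 0ℓ
  open CommutativeRing commRing public
  field
    ≈⇒≡     : ∀ {x y} → x ≈ y → x ≡ y
    0≢1     : ¬ (0# ≡ 1#)
    inverse : ∀ x → ¬ (x ≡ 0#) → ∃ λ y → x * y ≡ 1#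
    enum    : Fin q ↔ Carrier

  idx : Carrier → Fin q
  idx = Inverse.from enum

count : {n : ℕ} → (Fin n → Bool) → ℕ
count f = ∣ tabulate f ∣

-- Incidence structures on the points of a finite field F:
-- b blocks, block j being the subset B j of Fin q (points are field
-- elements, identified with Fin q through the enumeration of F).
module _ {q : ℕ} (F : FiniteField q) where
  open FiniteField F
  open import Data.Fin.Subset.Properties using (_∈?_)

  _∈B_ : Carrier → Subset q → Set
  x ∈B S = idx x ∈ S

  replication : {b : ℕ} → (Fin b → Subset q) → Carrier → ℕ
  replication B x = count (λ j → does (idx x ∈? B j))

  pairCount : {b : ℕ} → (Fin b → Subset q) → Carrier → Carrier → ℕ
  pairCount B x y = count (λ j → does (idx x ∈? B j) ∧ does (idx y ∈? B j))

  record Is2Design {b : ℕ} (k λ' : ℕ) (B : Fin b → Subset q) : Set where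
    field
      distinctBlocks : ∀ i j → B i ≡ B j → i ≡ j
      blockSize      : ∀ j → ∣ B j ∣ ≡ k
      balanced       : ∀ x y → ¬ (x ≡ y) → pairCount B x y ≡ λ'

  MapsBlock : {b : ℕ} → (Fin b → Subset q) → Carrier → Carrier → Fin b → Fin b → Set
  MapsBlock B a c i j = ∀ x → (x ∈B B i → ((a * x) + c) ∈B B j)
                            × (((a * x) + c) ∈B B j → x ∈B B i)

  AGL1Automorphisms : {b : ℕ} → (Fin b → Subset q) → Set
  AGL1Automorphisms B = ∀ a c → ¬ (a ≡ 0#) → ∀ i → ∃ λ j → MapsBlock B a c i j

  AGL1FlagTransitive : {b : ℕ} → (Fin b → Subset q) → Set
  AGL1FlagTransitive B = ∀ x i y j → x ∈B B i → y ∈B B j →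
    Σ Carrier λ a → Σ Carrier λ c → ¬ (a ≡ 0#) × ((a * x) + c ≡ y) × MapsBlock B a c i j

  HasOrder3 : Carrier → Set
  HasOrder3 ζ = ¬ (ζ ≡ 1#) × (ζ * (ζ * ζ) ≡ 1#)

  InTriple : Carrier → Carrier → Carrier → Carrier → Set
  InTriple ζ a c x = (x ≡ c + a) ⊎ (x ≡ c + (a * ζ)) ⊎ (x ≡ c + (a * (ζ * ζ)))

-- Write G for AGL₁(q) and G_B for the stabiliser of a block B.  As G is sharply
-- 2-transitive on points and λ = 2, G_B has at most two orbits on ordered pairs
-- of distinct points of B (a third would give a third block through one pair),
-- and not just one (pulling back the two blocks through a pair would identify
-- them).  Played against a nontrivial translation in G_B, these two facts give a
-- contradiction, so elements of G_B are determined by their multipliers: G_B is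
-- abelian and only the identity fixes a point of B.  Hence the pairs (x, y) with
-- y ∈ B ∖ {x} lie in different orbits and k = 3; an element of G_B moving a
-- point of B is then a 3-cycle z ↦ ζ z + c with ζ of order 3, so B is c′ + a⟨ζ⟩,
-- and flag-transitivity carries this shape to every block.  Finally,
-- multiplication by ζ splits GF(q)* into orbits of size 3.

{-# OPTIONS --safe #-}
module Submission where

open import Defs
open import Data.Nat as ℕ using (ℕ; zero; suc; _<_; _≤_; z≤n; s≤s; s<s⁻¹; _%_; _^_; _≤?_)
open import Data.Nat.Properties
  using (≤-antisym; ≤-trans; ≤-reflexive; <-≤-trans; <-trans; m+[n∸m]≡n; +-suc; n<1+n; ≤-refl; n≤1+n; >⇒≢; ≤⇒≯; ≰⇒>)
open import Data.Nat.Divisibility using (_∣_; divides; _∣0; ∣m∣n⇒∣m+n; ∣-refl)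
open import Data.Nat.DivMod using ([m+kn]%n≡m%n)
open import Data.Nat.Induction using (<-rec)
open import Data.Nat.GeneralisedArithmetic using (fold)
open import Data.Nat.Primality using (Prime)
import Data.Integer as ℤ
open import Data.Fin using (Fin; zero; suc; toℕ)
import Data.Fin.Properties as Fin
open import Data.Fin.Subset using (Subset; _∈_; _∉_; _⊆_; ∣_∣; ⊤; Nonempty; inside; outside)
open import Data.Fin.Subset.Properties
  using (_∈?_; ⊆-antisym; p─⊥≡p; x∈p⇒∣p-x∣<∣p∣; x∈p∧x≢y⇒x∈p-y; p─q⊆p; nonempty?; Empty-unique; ∣⊥∣≡0
        ; ∈⊤; ∣⊤∣≡n)
open import Data.Vec using (_∷_; there; tabulate; lookup)
open import Data.Vec.Properties using (lookup∘tabulate; []=⇒lookup; lookup⇒[]=)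
open import Data.Bool using (true; _∧_)
open import Data.List using (List; []; _∷_; length; map)
open import Data.List.Properties using (length-map)
open import Data.List.Relation.Unary.All as All using (All; []; _∷_)
import Data.List.Relation.Unary.All.Properties as All
open import Data.List.Relation.Unary.Unique.Propositional using (Unique; []; _∷_)
import Data.List.Relation.Unary.Unique.Propositional.Properties as Unique
open import Data.Empty using (⊥; ⊥-elim)
open import Data.Product using (Σ; ∃; ∃₂; _×_; _,_; proj₁; proj₂)
open import Data.Sum as Sum using (_⊎_; inj₁; inj₂)
open import Function using (Inverse; _∘_; flip)
open import Function.Definitions using (Injective)
open import Relation.Nullary using (¬_; Dec; yes; no; does; contradiction)
open import Relation.Nullary.Decidable using (map′; dec-true; decidable-stable)
open import Relation.Binary.PropositionalEquality
open import Algebra.Bundles using (CommutativeRing)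

module FiniteSubsets where

  open import Data.Fin.Subset using (_-_)

  ∣p∣≤1+∣p-x∣ : ∀ {n} (p : Subset n) x → ∣ p ∣ ≤ suc ∣ p - x ∣
  ∣p∣≤1+∣p-x∣ (inside ∷ p) zero = s≤s (≤-reflexive (cong ∣_∣ (sym (p─⊥≡p p))))
  ∣p∣≤1+∣p-x∣ (outside ∷ p) zero = ≤-trans (n≤1+n _) (s≤s (≤-reflexive (cong ∣_∣ (sym (p─⊥≡p p)))))
  ∣p∣≤1+∣p-x∣ (inside ∷ p) (suc x) = s≤s (∣p∣≤1+∣p-x∣ p x)
  ∣p∣≤1+∣p-x∣ (outside ∷ p) (suc x) = ∣p∣≤1+∣p-x∣ p x

  x∉p-x : ∀ {n} (p : Subset n) x → x ∉ p - x
  x∉p-x (s ∷ p) zero ()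
  x∉p-x (s ∷ p) (suc x) (there x∈p-x) = x∉p-x p x x∈p-x

  x∈p-y⇒x≢y : ∀ {n} {p : Subset n} {x y} → x ∈ p - y → x ≢ y
  x∈p-y⇒x≢y {p = p} x∈p-y refl = x∉p-x p _ x∈p-y

  x∈p-y⇒x∈p : ∀ {n} {p : Subset n} {x y} → x ∈ p - y → x ∈ p
  x∈p-y⇒x∈p {p = p} = p─q⊆p p _

  ∣p∣≡1+∣p-x∣ : ∀ {n} {p : Subset n} {x} → x ∈ p → ∣ p ∣ ≡ suc ∣ p - x ∣
  ∣p∣≡1+∣p-x∣ {p = p} {x} x∈p = ≤-antisym (∣p∣≤1+∣p-x∣ p x) (x∈p⇒∣p-x∣<∣p∣ x∈p)

  ∣p∣>0⇒nonempty : ∀ {n} (p : Subset n) → 0 < ∣ p ∣ → Nonempty p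
  ∣p∣>0⇒nonempty {n} p 0<∣p∣ with nonempty? p
  ... | yes ne = ne
  ... | no ¬ne = contradiction (trans (cong ∣_∣ (Empty-unique ¬ne)) (∣⊥∣≡0 n)) (>⇒≢ 0<∣p∣)

  fresh-member : ∀ {n} (p : Subset n) (xs : List (Fin n)) → length xs < ∣ p ∣ →
                 ∃ λ y → y ∈ p × All (y ≢_) xs
  fresh-member p [] 0<∣p∣ = let y , y∈p = ∣p∣>0⇒nonempty p 0<∣p∣ in y , y∈p , []
  fresh-member p (x ∷ xs) |xs|<∣p∣ =
    let y , y∈p-x , y∉xs = fresh-member (p - x) xs (s<s⁻¹ (<-≤-trans |xs|<∣p∣ (∣p∣≤1+∣p-x∣ p x)))
    in y , x∈p-y⇒x∈p y∈p-x , x∈p-y⇒x≢y y∈p-x ∷ y∉xs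

  unique⇒length≤∣p∣ : ∀ {n} {p : Subset n} {xs} → Unique xs → All (_∈ p) xs → length xs ≤ ∣ p ∣
  unique⇒length≤∣p∣ [] [] = z≤n
  unique⇒length≤∣p∣ {p = p} (x≢xs ∷ xs!) (x∈p ∷ xs⊆p) = <-≤-trans
    (s≤s (unique⇒length≤∣p∣ xs! (All.zipWith (λ (y∈p , x≢y) → x∈p∧x≢y⇒x∈p-y y∈p (≢-sym x≢y)) (xs⊆p , x≢xs))))
    (≤-reflexive (sym (∣p∣≡1+∣p-x∣ x∈p)))

  injective-preserving⇒onto : ∀ {A : Set} {n} {ι : A → Fin n} → Injective _≡_ _≡_ ι →
    (P : A → Set) (ψ : A → A) → Injective _≡_ _≡_ ψ → (∀ {a} → P a → P (ψ a)) →
    ∀ {z} → P z → ∃ λ a → P a × ψ a ≡ z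
  injective-preserving⇒onto {n = n} {ι} ι-injective P ψ ψ-injective ψ-preserves {z} Pz
    with i , j , i<j , ιi≡ιj ← Fin.pigeonhole (n<1+n n) (λ m → ι (fold z ψ (toℕ m))) =
    fold z ψ e , P-orbit e , sym (cancel (toℕ i) (trans (ι-injective ιi≡ιj) (cong (fold z ψ) (sym i+1+e≡j))))
    where
    e : ℕ
    e = toℕ j ℕ.∸ suc (toℕ i)

    i+1+e≡j : toℕ i ℕ.+ suc e ≡ toℕ j
    i+1+e≡j = trans (+-suc (toℕ i) e) (m+[n∸m]≡n i<j)

    P-orbit : ∀ m → P (fold z ψ m)
    P-orbit zero = Pz
    P-orbit (suc m) = ψ-preserves (P-orbit m)

    cancel : ∀ m {d} → fold z ψ m ≡ fold z ψ (m ℕ.+ d) → z ≡ fold z ψ d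
    cancel zero eq = eq
    cancel (suc m) eq = cancel m (ψ-injective eq)

  module _ {n} (σ : Fin n → Fin n) (σ³≡id : ∀ i → σ (σ (σ i)) ≡ i) where

    private
      σ-injective : ∀ {i j} → σ i ≡ σ j → i ≡ j
      σ-injective {i} {j} eq = trans (sym (σ³≡id i)) (trans (cong (λ t → σ (σ t)) eq) (σ³≡id j))

    ClosedFixedPointFree : Subset n → Set
    ClosedFixedPointFree p = ∀ {i} → i ∈ p → σ i ∈ p × σ i ≢ i

    3∣∣p∣ : ∀ p → ClosedFixedPointFree p → 3 ∣ ∣ p ∣
    3∣∣p∣ p = <-rec Motive step ∣ p ∣ p refl
      where
      Motive : ℕ → Set
      Motive m = ∀ p → ∣ p ∣ ≡ m → ClosedFixedPointFree p → 3 ∣ m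

      step : ∀ m → (∀ {m′} → m′ < m → Motive m′) → Motive m
      step zero _ _ _ _ = 3 ∣0
      step (suc m) ih p ∣p∣≡1+m σ-on-p with i , i∈p ← ∣p∣>0⇒nonempty p (subst (0 <_) (sym ∣p∣≡1+m) (s≤s z≤n)) =
        subst (3 ∣_) (trans (sym ∣p∣≡3+∣p₃∣) ∣p∣≡1+m)
          (∣m∣n⇒∣m+n ∣-refl (ih (subst (∣ p₃ ∣ <_) ∣p∣≡1+m ∣p₃∣<∣p∣) p₃ refl σ-on-p₃))
        where
        σ²i≢i : σ (σ i) ≢ i
        σ²i≢i eq = proj₂ (σ-on-p i∈p) (trans (sym (cong σ eq)) (σ³≡id i))

        p₃ : Subset _
        p₃ = p - i - σ i - σ (σ i)

        σi∈p-i : σ i ∈ p - i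
        σi∈p-i = x∈p∧x≢y⇒x∈p-y (proj₁ (σ-on-p i∈p)) (proj₂ (σ-on-p i∈p))

        σ²i∈p-i-σi : σ (σ i) ∈ p - i - σ i
        σ²i∈p-i-σi = x∈p∧x≢y⇒x∈p-y (x∈p∧x≢y⇒x∈p-y (proj₁ (σ-on-p (proj₁ (σ-on-p i∈p)))) σ²i≢i)
                                    (proj₂ (σ-on-p (proj₁ (σ-on-p i∈p))))

        ∣p∣≡3+∣p₃∣ : ∣ p ∣ ≡ 3 ℕ.+ ∣ p₃ ∣
        ∣p∣≡3+∣p₃∣ = trans (∣p∣≡1+∣p-x∣ i∈p)
          (cong suc (trans (∣p∣≡1+∣p-x∣ σi∈p-i) (cong suc (∣p∣≡1+∣p-x∣ σ²i∈p-i-σi))))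

        ∣p₃∣<∣p∣ : ∣ p₃ ∣ < ∣ p ∣
        ∣p₃∣<∣p∣ = ≤-trans (n≤1+n _) (≤-trans (n≤1+n _) (≤-reflexive (sym ∣p∣≡3+∣p₃∣)))

        σ-on-p₃ : ClosedFixedPointFree p₃
        σ-on-p₃ {j} j∈p₃ =
          x∈p∧x≢y⇒x∈p-y (x∈p∧x≢y⇒x∈p-y (x∈p∧x≢y⇒x∈p-y σj∈p σj≢i) σj≢σi) σj≢σ²i , proj₂ (σ-on-p j∈p)
          where
          j∈p-i-σi = x∈p-y⇒x∈p j∈p₃
          j∈p-i = x∈p-y⇒x∈p j∈p-i-σi
          j∈p = x∈p-y⇒x∈p j∈p-i
          σj∈p = proj₁ (σ-on-p j∈p)
          σj≢i : σ j ≢ i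
          σj≢i eq = x∈p-y⇒x≢y j∈p₃ (trans (sym (σ³≡id j)) (cong (λ t → σ (σ t)) eq))
          σj≢σi : σ j ≢ σ i
          σj≢σi eq = x∈p-y⇒x≢y j∈p-i (σ-injective eq)
          σj≢σ²i : σ j ≢ σ (σ i)
          σj≢σ²i eq = x∈p-y⇒x≢y j∈p-i-σi (σ-injective eq)

    unique-fixed-point⇒n%3≡1 : ∀ e → σ e ≡ e → (∀ i → σ i ≡ i → i ≡ e) → n % 3 ≡ 1
    unique-fixed-point⇒n%3≡1 e σe≡e fixed⇒e = 1+3m%3≡1 (3∣∣p∣ (⊤ - e) σ-on-⊤-e)
      where
      σ-on-⊤-e : ClosedFixedPointFree (⊤ - e)
      σ-on-⊤-e j∈⊤-e = x∈p∧x≢y⇒x∈p-y ∈⊤ (λ σj≡e → x∈p-y⇒x≢y j∈⊤-e (σ-injective (trans σj≡e (sym σe≡e))))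
                     , λ σj≡j → x∈p-y⇒x≢y j∈⊤-e (fixed⇒e _ σj≡j)

      1+3m%3≡1 : 3 ∣ ∣ ⊤ - e ∣ → n % 3 ≡ 1
      1+3m%3≡1 (divides m ∣⊤-e∣≡m*3) = begin
        n % 3               ≡⟨ cong (_% 3) (trans (sym (∣⊤∣≡n n)) (∣p∣≡1+∣p-x∣ (∈⊤ {x = e}))) ⟩
        suc ∣ ⊤ - e ∣ % 3   ≡⟨ cong (λ t → suc t % 3) ∣⊤-e∣≡m*3 ⟩
        suc (m ℕ.* 3) % 3     ≡⟨ [m+kn]%n≡m%n 1 m 3 ⟩
        1                   ∎
        where open ≡-Reasoning

open FiniteSubsets

-- The ring solver needs coefficients with computable equality; ℤ maps into every commutative ring.
module IntegerCoefficients {c ℓ} (R : CommutativeRing c ℓ) where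

  open import Data.Integer using (ℤ; +_; -[1+_]; _⊖_; _◃_)
  import Data.Integer.Properties as ℤ
  open import Data.Sign as Sign using (Sign)
  open import Data.Maybe as Maybe using ()
  open import Relation.Nullary.Decidable using (dec⇒maybe)
  open import Algebra.Solver.Ring.AlmostCommutativeRing using (fromCommutativeRing; _-Raw-AlmostCommutative⟶_)

  open CommutativeRing R renaming (refl to ≈-refl; sym to ≈-sym; trans to ≈-trans)
  open import Algebra.Properties.Semiring.Mult.TCOptimised semiring
    using (1+×; ×-homo-+; ×1-homo-*) renaming (_×_ to _×′_)
  open import Algebra.Properties.Ring ring using (-1*x≈-x; -0#≈0#)
  open import Algebra.Properties.AbelianGroup +-abelianGroup using (⁻¹-∙-comm)
  open import Algebra.Properties.Group +-group using (⁻¹-involutive)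
  open import Algebra.Properties.CommutativeSemigroup +-commutativeSemigroup
    using () renaming (interchange to +-interchange)
  open import Algebra.Properties.CommutativeSemigroup *-commutativeSemigroup
    using () renaming (interchange to *-interchange)
  open import Relation.Binary.Reasoning.Setoid (CommutativeRing.setoid R)

  private
    ι : ℕ → Carrier
    ι n = n ×′ 1#

    sign⟦_⟧ : Sign → Carrier
    sign⟦ Sign.+ ⟧ = 1#
    sign⟦ Sign.- ⟧ = - 1#

  ⟦_⟧ℤ : ℤ → Carrier
  ⟦ + n ⟧ℤ = ι n
  ⟦ -[1+ n ] ⟧ℤ = - ι (suc n)

  private
    ⊖-homo : ∀ m n → ⟦ m ⊖ n ⟧ℤ ≈ ι m - ι n
    ⊖-homo zero zero = ≈-sym (≈-trans (+-identityˡ _) -0#≈0#)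
    ⊖-homo zero (suc n) = ≈-sym (+-identityˡ _)
    ⊖-homo (suc m) zero = ≈-sym (≈-trans (+-congˡ -0#≈0#) (+-identityʳ _))
    ⊖-homo (suc m) (suc n) = begin
      ⟦ suc m ⊖ suc n ⟧ℤ           ≡⟨ cong ⟦_⟧ℤ (ℤ.[1+m]⊖[1+n]≡m⊖n m n) ⟩
      ⟦ m ⊖ n ⟧ℤ                   ≈⟨ ⊖-homo m n ⟩
      ι m - ι n                    ≈⟨ +-identityˡ _ ⟨
      0# + (ι m - ι n)             ≈⟨ +-congʳ (-‿inverseʳ 1#) ⟨
      (1# - 1#) + (ι m - ι n)      ≈⟨ +-interchange 1# (- 1#) (ι m) (- ι n) ⟩
      (1# + ι m) + (- 1# - ι n)    ≈⟨ +-congˡ (⁻¹-∙-comm 1# (ι n)) ⟩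
      (1# + ι m) - (1# + ι n)      ≈⟨ +-cong (1+× m 1#) (-‿cong (1+× n 1#)) ⟨
      ι (suc m) - ι (suc n)        ∎

    ◃-homo : ∀ s n → ⟦ s ◃ n ⟧ℤ ≈ sign⟦ s ⟧ * ι n
    ◃-homo s zero = ≈-sym (zeroʳ _)
    ◃-homo Sign.+ (suc n) = ≈-sym (*-identityˡ _)
    ◃-homo Sign.- (suc n) = ≈-sym (-1*x≈-x _)

    sign-homo : ∀ s t → sign⟦ s Sign.* t ⟧ ≈ sign⟦ s ⟧ * sign⟦ t ⟧
    sign-homo Sign.+ t = ≈-sym (*-identityˡ _)
    sign-homo Sign.- Sign.+ = ≈-sym (*-identityʳ _)
    sign-homo Sign.- Sign.- = ≈-sym (≈-trans (-1*x≈-x _) (⁻¹-involutive 1#))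

    sign-abs : ∀ i → ⟦ i ⟧ℤ ≈ sign⟦ ℤ.sign i ⟧ * ι ℤ.∣ i ∣
    sign-abs i = ≈-trans (reflexive (cong ⟦_⟧ℤ (sym (ℤ.◃-inverse i)))) (◃-homo (ℤ.sign i) ℤ.∣ i ∣)

  ⟦⟧ℤ-+-homo : ∀ i j → ⟦ i ℤ.+ j ⟧ℤ ≈ ⟦ i ⟧ℤ + ⟦ j ⟧ℤ
  ⟦⟧ℤ-+-homo (+ m) (+ n) = ×-homo-+ 1# m n
  ⟦⟧ℤ-+-homo (+ m) -[1+ n ] = ⊖-homo m (suc n)
  ⟦⟧ℤ-+-homo -[1+ m ] (+ n) = ≈-trans (⊖-homo n (suc m)) (+-comm _ _)
  ⟦⟧ℤ-+-homo -[1+ m ] -[1+ n ] = begin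
    - ι (suc (suc (m ℕ.+ n)))     ≡⟨ cong (-_ ∘ ι) (sym (+-suc (suc m) n)) ⟩
    - ι (suc m ℕ.+ suc n)         ≈⟨ -‿cong (×-homo-+ 1# (suc m) (suc n)) ⟩
    - (ι (suc m) + ι (suc n))     ≈⟨ ⁻¹-∙-comm _ _ ⟨
    - ι (suc m) - ι (suc n)       ∎

  ⟦⟧ℤ-*-homo : ∀ i j → ⟦ i ℤ.* j ⟧ℤ ≈ ⟦ i ⟧ℤ * ⟦ j ⟧ℤ
  ⟦⟧ℤ-*-homo i j = begin
    ⟦ i ℤ.* j ⟧ℤ                                         ≈⟨ ◃-homo (s Sign.* t) (ℤ.∣ i ∣ ℕ.* ℤ.∣ j ∣) ⟩
    sign⟦ s Sign.* t ⟧ * ι (ℤ.∣ i ∣ ℕ.* ℤ.∣ j ∣)          ≈⟨ *-cong (sign-homo s t) (×1-homo-* ℤ.∣ i ∣ ℤ.∣ j ∣) ⟩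
    (sign⟦ s ⟧ * sign⟦ t ⟧) * (ι ℤ.∣ i ∣ * ι ℤ.∣ j ∣)    ≈⟨ *-interchange _ _ _ _ ⟩
    (sign⟦ s ⟧ * ι ℤ.∣ i ∣) * (sign⟦ t ⟧ * ι ℤ.∣ j ∣)    ≈⟨ *-cong (sign-abs i) (sign-abs j) ⟨
    ⟦ i ⟧ℤ * ⟦ j ⟧ℤ                                      ∎
    where
    s = ℤ.sign i
    t = ℤ.sign j

  ⟦⟧ℤ-neg-homo : ∀ i → ⟦ ℤ.- i ⟧ℤ ≈ - ⟦ i ⟧ℤ
  ⟦⟧ℤ-neg-homo -[1+ n ] = ≈-sym (⁻¹-involutive _)
  ⟦⟧ℤ-neg-homo (+ zero) = ≈-sym -0#≈0#
  ⟦⟧ℤ-neg-homo (+ suc n) = ≈-refl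

  ⟦⟧ℤ-morphism : ℤ.+-*-rawRing -Raw-AlmostCommutative⟶ fromCommutativeRing R
  ⟦⟧ℤ-morphism = record
    { ⟦_⟧ = ⟦_⟧ℤ
    ; +-homo = ⟦⟧ℤ-+-homo
    ; *-homo = ⟦⟧ℤ-*-homo
    ; -‿homo = ⟦⟧ℤ-neg-homo
    ; 0-homo = ≈-refl
    ; 1-homo = ≈-refl
    }

  open import Algebra.Solver.Ring ℤ.+-*-rawRing (fromCommutativeRing R) ⟦⟧ℤ-morphism
    (λ i j → Maybe.map (reflexive ∘ cong ⟦_⟧ℤ) (dec⇒maybe (i ℤ.≟ j))) public
    using (solve; _:=_; _:+_; _:-_; _:*_; :-_; con)

module FiniteFieldProperties {q : ℕ} (F : FiniteField q) where

  open FiniteField F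
    using (Carrier; _+_; _*_; -_; _-_; 0#; 1#; ≈⇒≡; 0≢1; inverse; idx; enum; commRing; ring; +-group
          ; +-identityʳ; *-identityˡ; *-identityʳ; zeroˡ; zeroʳ; *-assoc; -‿inverseʳ; reflexive)
    renaming (refl to ≈-refl)
  open IntegerCoefficients commRing public using (solve; _:=_; _:+_; _:-_; _:*_; :-_; con)
  open import Algebra.Properties.Ring ring using (-1*x≈-x)
  open import Algebra.Properties.Group +-group using (x∙y⁻¹≈ε⇒x≈y; ∙-cancelˡ; inverseˡ-unique)

  from-enum : Fin q → Carrier
  from-enum = Inverse.to enum

  from-enum∘idx : ∀ x → from-enum (idx x) ≡ x
  from-enum∘idx = Inverse.strictlyInverseˡ enum

  idx∘from-enum : ∀ i → idx (from-enum i) ≡ i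
  idx∘from-enum = Inverse.strictlyInverseʳ enum

  idx-injective : ∀ {x y} → idx x ≡ idx y → x ≡ y
  idx-injective {x} {y} eq = trans (sym (from-enum∘idx x)) (trans (cong from-enum eq) (from-enum∘idx y))

  infix 4 _≟_
  _≟_ : (x y : Carrier) → Dec (x ≡ y)
  x ≟ y = map′ idx-injective (cong idx) (idx x Fin.≟ idx y)

  1≢0 : 1# ≢ 0#
  1≢0 = 0≢1 ∘ sym

  x-y≡0⇒x≡y : ∀ {x y} → x - y ≡ 0# → x ≡ y
  x-y≡0⇒x≡y {x} {y} eq = ≈⇒≡ (x∙y⁻¹≈ε⇒x≈y x y (reflexive eq))

  x≢y⇒x-y≢0 : ∀ {x y} → x ≢ y → x - y ≢ 0#
  x≢y⇒x-y≢0 x≢y = x≢y ∘ x-y≡0⇒x≡y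

  +-cancelˡ : ∀ x {y z} → x + y ≡ x + z → y ≡ z
  +-cancelˡ x {y} {z} eq = ≈⇒≡ (∙-cancelˡ x y z (reflexive eq))

  x+y≡0⇒x≡-y : ∀ {x y} → x + y ≡ 0# → x ≡ - y
  x+y≡0⇒x≡-y {x} {y} eq = ≈⇒≡ (inverseˡ-unique x y (reflexive eq))

  -1*x≡-x : ∀ x → - 1# * x ≡ - x
  -1*x≡-x x = ≈⇒≡ (-1*x≈-x x)

  -1≢0 : - 1# ≢ 0#
  -1≢0 -1≡0 = 1≢0 (trans (sym (≈⇒≡ (+-identityʳ 1#))) (trans (cong (1# +_) (sym -1≡0)) (≈⇒≡ (-‿inverseʳ 1#))))

  x≢x+t : ∀ {t} x → t ≢ 0# → x ≢ x + t
  x≢x+t {t} x t≢0 x≡x+t = t≢0 (begin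
    t              ≡⟨ ≈⇒≡ (solve 2 (λ x t → t := (x :+ t) :- x) ≈-refl x t) ⟩
    (x + t) - x    ≡⟨ cong (_- x) (sym x≡x+t) ⟩
    x - x          ≡⟨ ≈⇒≡ (-‿inverseʳ x) ⟩
    0#             ∎)
    where open ≡-Reasoning

  _⁻¹⟨_⟩ : (x : Carrier) → x ≢ 0# → Carrier
  x ⁻¹⟨ x≢0 ⟩ = proj₁ (inverse x x≢0)

  x*x⁻¹≡1 : ∀ {x} (x≢0 : x ≢ 0#) → x * x ⁻¹⟨ x≢0 ⟩ ≡ 1#
  x*x⁻¹≡1 {x} x≢0 = proj₂ (inverse x x≢0)

  x*t*t⁻¹≡x : ∀ x {t} (t≢0 : t ≢ 0#) → x * t * t ⁻¹⟨ t≢0 ⟩ ≡ x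
  x*t*t⁻¹≡x x {t} t≢0 = begin
    x * t * t ⁻¹⟨ t≢0 ⟩    ≡⟨ ≈⇒≡ (*-assoc x t _) ⟩
    x * (t * t ⁻¹⟨ t≢0 ⟩)  ≡⟨ cong (x *_) (x*x⁻¹≡1 t≢0) ⟩
    x * 1#                 ≡⟨ ≈⇒≡ (*-identityʳ x) ⟩
    x                      ∎
    where open ≡-Reasoning

  x*t⁻¹*t≡x : ∀ x {t} (t≢0 : t ≢ 0#) → x * t ⁻¹⟨ t≢0 ⟩ * t ≡ x
  x*t⁻¹*t≡x x {t} t≢0 = trans (≈⇒≡ (solve 3 (λ x s t → x :* s :* t := x :* t :* s) ≈-refl x _ t)) (x*t*t⁻¹≡x x t≢0)

  *-cancelʳ-nonzero : ∀ {x y t} → t ≢ 0# → x * t ≡ y * t → x ≡ y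
  *-cancelʳ-nonzero {x} {y} t≢0 eq =
    trans (sym (x*t*t⁻¹≡x x t≢0)) (trans (cong (_* _) eq) (x*t*t⁻¹≡x y t≢0))

  *-nonzero : ∀ {x y} → x ≢ 0# → y ≢ 0# → x * y ≢ 0#
  *-nonzero {x} {y} x≢0 y≢0 xy≡0 = x≢0 (*-cancelʳ-nonzero y≢0 (trans xy≡0 (sym (≈⇒≡ (zeroˡ y)))))

  x*y≡0⇒y≡0 : ∀ {x y} → x ≢ 0# → x * y ≡ 0# → y ≡ 0#
  x*y≡0⇒y≡0 {y = y} x≢0 xy≡0 = decidable-stable (y ≟ 0#) (λ y≢0 → *-nonzero x≢0 y≢0 xy≡0)

  ⁻¹-nonzero : ∀ {x} (x≢0 : x ≢ 0#) → x ⁻¹⟨ x≢0 ⟩ ≢ 0#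
  ⁻¹-nonzero {x} x≢0 x⁻¹≡0 = 1≢0 (trans (sym (x*x⁻¹≡1 x≢0)) (trans (cong (x *_) x⁻¹≡0) (≈⇒≡ (zeroʳ x))))

  order3⇒q%3≡1 : ∀ {ζ} → HasOrder3 F ζ → q % 3 ≡ 1
  order3⇒q%3≡1 {ζ} (ζ≢1 , ζ³≡1) = unique-fixed-point⇒n%3≡1 σ σ³≡id (idx 0#) σ0≡0 fixed⇒0
    where
    open ≡-Reasoning
    σ : Fin q → Fin q
    σ j = idx (ζ * from-enum j)

    σ³≡id : ∀ j → σ (σ (σ j)) ≡ j
    σ³≡id j = begin
      idx (ζ * from-enum (idx (ζ * from-enum (idx (ζ * from-enum j)))))
        ≡⟨ cong (λ w → idx (ζ * w)) (trans (from-enum∘idx _) (cong (ζ *_) (from-enum∘idx _))) ⟩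
      idx (ζ * (ζ * (ζ * from-enum j)))
        ≡⟨ cong idx (≈⇒≡ (solve 2 (λ ζ w → ζ :* (ζ :* (ζ :* w)) := ζ :* (ζ :* ζ) :* w) ≈-refl ζ _)) ⟩
      idx (ζ * (ζ * ζ) * from-enum j)    ≡⟨ cong (λ e → idx (e * from-enum j)) ζ³≡1 ⟩
      idx (1# * from-enum j)             ≡⟨ cong idx (≈⇒≡ (*-identityˡ _)) ⟩
      idx (from-enum j)                  ≡⟨ idx∘from-enum j ⟩
      j                                  ∎

    σ0≡0 : σ (idx 0#) ≡ idx 0#
    σ0≡0 = cong idx (trans (cong (ζ *_) (from-enum∘idx 0#)) (≈⇒≡ (zeroʳ ζ)))

    fixed⇒0 : ∀ j → σ j ≡ j → j ≡ idx 0#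
    fixed⇒0 j σj≡j = trans (sym (idx∘from-enum j)) (cong idx (x*y≡0⇒y≡0 (x≢y⇒x-y≢0 ζ≢1) (begin
      (ζ - 1#) * w     ≡⟨ ≈⇒≡ (solve 2 (λ ζ w → (ζ :- con (ℤ.+ 1)) :* w := ζ :* w :- w) ≈-refl ζ w) ⟩
      ζ * w - w        ≡⟨ cong (_- w) ζw≡w ⟩
      w - w            ≡⟨ ≈⇒≡ (-‿inverseʳ w) ⟩
      0#               ∎)))
      where
      w = from-enum j
      ζw≡w : ζ * w ≡ w
      ζw≡w = idx-injective (trans σj≡j (sym (idx∘from-enum j)))

module AffineMaps {q : ℕ} (F : FiniteField q) where

  open FiniteField F
    using (Carrier; _+_; _*_; -_; _-_; 0#; 1#; ≈⇒≡; +-identityʳ; *-identityˡ; *-identityʳ; zeroˡ; *-comm; *-assoc)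
    renaming (refl to ≈-refl)
  open FiniteFieldProperties F

  record Affine : Set where
    constructor affine
    field
      scale shift scale⁻¹ : Carrier
      scale*scale⁻¹≡1 : scale * scale⁻¹ ≡ 1#

  open Affine public

  ⟦_⟧ : Affine → Carrier → Carrier
  ⟦ g ⟧ x = scale g * x + shift g

  mkAffine : (a c : Carrier) → a ≢ 0# → Affine
  mkAffine a c a≢0 = affine a c (a ⁻¹⟨ a≢0 ⟩) (x*x⁻¹≡1 a≢0)

  scale≢0 : ∀ g → scale g ≢ 0#
  scale≢0 g a≡0 = 1≢0 (trans (sym (scale*scale⁻¹≡1 g)) (trans (cong (_* scale⁻¹ g) a≡0) (≈⇒≡ (zeroˡ _))))

  translation : Carrier → Affine
  translation w = affine 1# w 1# (≈⇒≡ (*-identityʳ 1#))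

  id : Affine
  id = translation 0#

  infixr 9 _∙_
  _∙_ : Affine → Affine → Affine
  g ∙ f = affine (scale g * scale f) (scale g * shift f + shift g) (scale⁻¹ f * scale⁻¹ g) (begin
    scale g * scale f * (scale⁻¹ f * scale⁻¹ g)    ≡⟨ ≈⇒≡ (solve 4 (λ a b b′ a′ → a :* b :* (b′ :* a′) := a :* a′ :* (b :* b′))
                                                        ≈-refl (scale g) (scale f) (scale⁻¹ f) (scale⁻¹ g)) ⟩
    scale g * scale⁻¹ g * (scale f * scale⁻¹ f)    ≡⟨ cong₂ _*_ (scale*scale⁻¹≡1 g) (scale*scale⁻¹≡1 f) ⟩
    1# * 1#                                        ≡⟨ ≈⇒≡ (*-identityʳ 1#) ⟩
    1#                                             ∎)
    where open ≡-Reasoning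

  _⁻¹ : Affine → Affine
  g ⁻¹ = affine (scale⁻¹ g) (- (scale⁻¹ g * shift g)) (scale g) (trans (≈⇒≡ (*-comm _ _)) (scale*scale⁻¹≡1 g))

  ⟦translation⟧ : ∀ w z → ⟦ translation w ⟧ z ≡ z + w
  ⟦translation⟧ w z = cong (_+ w) (≈⇒≡ (*-identityˡ z))

  ⟦id⟧ : ∀ z → ⟦ id ⟧ z ≡ z
  ⟦id⟧ z = trans (⟦translation⟧ 0# z) (≈⇒≡ (+-identityʳ z))

  ⟦∙⟧ : ∀ g f x → ⟦ g ∙ f ⟧ x ≡ ⟦ g ⟧ (⟦ f ⟧ x)
  ⟦∙⟧ g f x = ≈⇒≡ (solve 5 (λ a b c d x → a :* b :* x :+ (a :* d :+ c) := a :* (b :* x :+ d) :+ c)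
                     ≈-refl (scale g) (scale f) (shift g) (shift f) x)

  ⟦∙∙⟧ : ∀ g h f x → ⟦ g ∙ h ∙ f ⟧ x ≡ ⟦ g ⟧ (⟦ h ⟧ (⟦ f ⟧ x))
  ⟦∙∙⟧ g h f x = trans (⟦∙⟧ g (h ∙ f) x) (cong ⟦ g ⟧ (⟦∙⟧ h f x))

  ⟦⟧-+ : ∀ g x s → ⟦ g ⟧ (x + s) ≡ ⟦ g ⟧ x + scale g * s
  ⟦⟧-+ g x s = ≈⇒≡ (solve 4 (λ a c x s → a :* (x :+ s) :+ c := a :* x :+ c :+ a :* s) ≈-refl (scale g) (shift g) x s)

  ⟦⟧-- : ∀ g x y → ⟦ g ⟧ x - ⟦ g ⟧ y ≡ scale g * (x - y)
  ⟦⟧-- g x y = ≈⇒≡ (solve 4 (λ a c x y → a :* x :+ c :- (a :* y :+ c) := a :* (x :- y)) ≈-refl (scale g) (shift g) x y)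

  ⟦⁻¹⟧-inverseˡ : ∀ g x → ⟦ g ⁻¹ ⟧ (⟦ g ⟧ x) ≡ x
  ⟦⁻¹⟧-inverseˡ g x = begin
    scale⁻¹ g * (scale g * x + shift g) - scale⁻¹ g * shift g
      ≡⟨ ≈⇒≡ (solve 4 (λ a a′ c x → a′ :* (a :* x :+ c) :- a′ :* c := a :* a′ :* x) ≈-refl (scale g) (scale⁻¹ g) (shift g) x) ⟩
    scale g * scale⁻¹ g * x   ≡⟨ cong (_* x) (scale*scale⁻¹≡1 g) ⟩
    1# * x                    ≡⟨ ≈⇒≡ (*-identityˡ x) ⟩
    x                         ∎
    where open ≡-Reasoning

  ⟦⁻¹⟧-inverseʳ : ∀ g x → ⟦ g ⟧ (⟦ g ⁻¹ ⟧ x) ≡ x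
  ⟦⁻¹⟧-inverseʳ g x = begin
    scale g * (scale⁻¹ g * x - scale⁻¹ g * shift g) + shift g
      ≡⟨ ≈⇒≡ (solve 4 (λ a a′ c x → a :* (a′ :* x :- a′ :* c) :+ c := a :* a′ :* (x :- c) :+ c)
                      ≈-refl (scale g) (scale⁻¹ g) (shift g) x) ⟩
    scale g * scale⁻¹ g * (x - shift g) + shift g
      ≡⟨ cong (λ e → e * (x - shift g) + shift g) (scale*scale⁻¹≡1 g) ⟩
    1# * (x - shift g) + shift g
      ≡⟨ ≈⇒≡ (solve 2 (λ x c → con (ℤ.+ 1) :* (x :- c) :+ c := x) ≈-refl x (shift g)) ⟩
    x ∎
    where open ≡-Reasoning

  ⟦⟧-injective : ∀ g {x y} → ⟦ g ⟧ x ≡ ⟦ g ⟧ y → x ≡ y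
  ⟦⟧-injective g {x} {y} eq = trans (sym (⟦⁻¹⟧-inverseˡ g x)) (trans (cong ⟦ g ⁻¹ ⟧ eq) (⟦⁻¹⟧-inverseˡ g y))

  Trivial : Affine → Set
  Trivial g = scale g ≡ 1# × shift g ≡ 0#

  trivial⇒fixes : ∀ g → Trivial g → ∀ z → ⟦ g ⟧ z ≡ z
  trivial⇒fixes g (a≡1 , c≡0) z = trans (cong₂ (λ a c → a * z + c) a≡1 c≡0) (⟦id⟧ z)

  fixes⇒⟦⟧-+ : ∀ g {x} s → ⟦ g ⟧ x ≡ x → ⟦ g ⟧ (x + s) ≡ x + scale g * s
  fixes⇒⟦⟧-+ g {x} s gx≡x = trans (⟦⟧-+ g x s) (cong (_+ scale g * s) gx≡x)

  fix₂⇒trivial : ∀ g {u v} → ⟦ g ⟧ u ≡ u → ⟦ g ⟧ v ≡ v → u ≢ v → Trivial g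
  fix₂⇒trivial g {u} {v} gu≡u gv≡v u≢v = a≡1 , c≡0
    where
    open ≡-Reasoning
    a≡1 : scale g ≡ 1#
    a≡1 = *-cancelʳ-nonzero (x≢y⇒x-y≢0 u≢v) (begin
      scale g * (u - v)       ≡⟨ sym (⟦⟧-- g u v) ⟩
      ⟦ g ⟧ u - ⟦ g ⟧ v       ≡⟨ cong₂ _-_ gu≡u gv≡v ⟩
      u - v                   ≡⟨ ≈⇒≡ (*-identityˡ _) ⟨
      1# * (u - v)            ∎)
    c≡0 : shift g ≡ 0#
    c≡0 = begin
      shift g                 ≡⟨ ≈⇒≡ (solve 3 (λ a c u → c := a :* u :+ c :- a :* u) ≈-refl (scale g) (shift g) u) ⟩
      ⟦ g ⟧ u - scale g * u   ≡⟨ cong₂ (λ w a → w - a * u) gu≡u a≡1 ⟩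
      u - 1# * u              ≡⟨ ≈⇒≡ (solve 1 (λ u → u :- con (ℤ.+ 1) :* u := con (ℤ.+ 0)) ≈-refl u) ⟩
      0#                      ∎

  fixed-point : ∀ g → scale g ≢ 1# → ∃ λ f → ⟦ g ⟧ f ≡ f
  fixed-point g a≢1 = f , (begin
    scale g * f + shift g          ≡⟨ cong (scale g * f +_) (sym (x*t⁻¹*t≡x (shift g) 1-a≢0)) ⟩
    scale g * f + f * (1# - scale g) ≡⟨ ≈⇒≡ (solve 2 (λ a f → a :* f :+ f :* (con (ℤ.+ 1) :- a) := f) ≈-refl (scale g) f) ⟩
    f                              ∎)
    where
    open ≡-Reasoning
    1-a≢0 : 1# - scale g ≢ 0#
    1-a≢0 = x≢y⇒x-y≢0 (a≢1 ∘ sym)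
    f = shift g * (1# - scale g) ⁻¹⟨ 1-a≢0 ⟩

  two-transitive : ∀ {u v u′ v′} → u ≢ v → u′ ≢ v′ → ∃ λ g → ⟦ g ⟧ u ≡ u′ × ⟦ g ⟧ v ≡ v′
  two-transitive {u} {v} {u′} {v′} u≢v u′≢v′ = g , gu≡u′ , gv≡v′
    where
    open ≡-Reasoning
    v-u≢0 = x≢y⇒x-y≢0 (u≢v ∘ sym)
    a = (v′ - u′) * (v - u) ⁻¹⟨ v-u≢0 ⟩
    g = mkAffine a (u′ - a * u) (*-nonzero (x≢y⇒x-y≢0 (u′≢v′ ∘ sym)) (⁻¹-nonzero v-u≢0))
    gu≡u′ : ⟦ g ⟧ u ≡ u′
    gu≡u′ = ≈⇒≡ (solve 2 (λ au u′ → au :+ (u′ :- au) := u′) ≈-refl (a * u) u′)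
    gv≡v′ : ⟦ g ⟧ v ≡ v′
    gv≡v′ = begin
      a * v + (u′ - a * u)    ≡⟨ ≈⇒≡ (solve 4 (λ a v u u′ → a :* v :+ (u′ :- a :* u) := a :* (v :- u) :+ u′) ≈-refl a v u u′) ⟩
      a * (v - u) + u′        ≡⟨ cong (_+ u′) (x*t⁻¹*t≡x (v′ - u′) v-u≢0) ⟩
      (v′ - u′) + u′          ≡⟨ ≈⇒≡ (solve 2 (λ v′ u′ → v′ :- u′ :+ u′ := v′) ≈-refl v′ u′) ⟩
      v′                      ∎

  dilation : Carrier → (a : Carrier) → a ≢ 0# → Affine
  dilation x a a≢0 = mkAffine a (x - a * x) a≢0

  ⟦dilation⟧ : ∀ x {a} (a≢0 : a ≢ 0#) z → ⟦ dilation x a a≢0 ⟧ z ≡ x + a * (z - x)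
  ⟦dilation⟧ x {a} _ z = ≈⇒≡ (solve 3 (λ x a z → a :* z :+ (x :- a :* x) := x :+ a :* (z :- x)) ≈-refl x a z)

  InTriple-image : ∀ g {ζ a c v} → InTriple F ζ a c v → InTriple F ζ (scale g * a) (⟦ g ⟧ c) (⟦ g ⟧ v)
  InTriple-image g {ζ} {a} {c} (inj₁ refl) = inj₁ (⟦⟧-+ g c a)
  InTriple-image g {ζ} {a} {c} (inj₂ (inj₁ refl)) =
    inj₂ (inj₁ (trans (⟦⟧-+ g c (a * ζ)) (cong (⟦ g ⟧ c +_) (sym (≈⇒≡ (*-assoc _ a ζ))))))
  InTriple-image g {ζ} {a} {c} (inj₂ (inj₂ refl)) =
    inj₂ (inj₂ (trans (⟦⟧-+ g c (a * (ζ * ζ))) (cong (⟦ g ⟧ c +_) (sym (≈⇒≡ (*-assoc _ a (ζ * ζ)))))))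

  InTriple-preimage : ∀ g {ζ a c w} → InTriple F ζ (scale g * a) (⟦ g ⟧ c) w → InTriple F ζ a c (⟦ g ⁻¹ ⟧ w)
  InTriple-preimage g {ζ} {a} {c} {w} w∈ =
    subst₂ (λ a′ c′ → InTriple F ζ a′ c′ (⟦ g ⁻¹ ⟧ w)) a⁻¹[ab]≡b (⟦⁻¹⟧-inverseˡ g c) (InTriple-image (g ⁻¹) w∈)
    where
    a⁻¹[ab]≡b : scale⁻¹ g * (scale g * a) ≡ a
    a⁻¹[ab]≡b = begin
      scale⁻¹ g * (scale g * a)      ≡⟨ ≈⇒≡ (solve 3 (λ a′ a b → a′ :* (a :* b) := a :* a′ :* b) ≈-refl (scale⁻¹ g) (scale g) a) ⟩
      scale g * scale⁻¹ g * a        ≡⟨ cong (_* a) (scale*scale⁻¹≡1 g) ⟩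
      1# * a                         ≡⟨ ≈⇒≡ (*-identityˡ a) ⟩
      a                              ∎
      where open ≡-Reasoning

module Design {q : ℕ} (F : FiniteField q) {b : ℕ} (B : Fin b → Subset q) {k : ℕ}
              (design : Is2Design F k 2 B) (automorphisms : AGL1Automorphisms F B)
              (flag-transitive : AGL1FlagTransitive F B) where

  open FiniteField F using (Carrier; _+_; _*_; -_; _-_; 0#; 1#; idx; ≈⇒≡; +-assoc; +-comm; *-comm; zeroˡ) renaming (refl to ≈-refl)
  open FiniteFieldProperties F
  open AffineMaps F
  open Is2Design design

  infix 4 _∈ᴮ_
  _∈ᴮ_ : Carrier → Fin b → Set
  x ∈ᴮ j = _∈B_ F x (B j)

  -- pairCount F B x y is ∣ blocks-through x y ∣ by definition.
  blocks-through : Carrier → Carrier → Subset b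
  blocks-through x y = tabulate (λ j → does (idx x ∈? B j) ∧ does (idx y ∈? B j))

  ∈-blocks-through⁺ : ∀ {x y j} → x ∈ᴮ j → y ∈ᴮ j → j ∈ blocks-through x y
  ∈-blocks-through⁺ {x} {y} {j} x∈j y∈j = lookup⇒[]= j _ (begin
    lookup (blocks-through x y) j ≡⟨ lookup∘tabulate _ j ⟩
    does (idx x ∈? B j) ∧ does (idx y ∈? B j) ≡⟨ cong₂ _∧_ (dec-true (idx x ∈? B j) x∈j) (dec-true (idx y ∈? B j) y∈j) ⟩
    true ∎)
    where open ≡-Reasoning

  ∈-blocks-through⁻ : ∀ {x y j} → j ∈ blocks-through x y → x ∈ᴮ j × y ∈ᴮ j
  ∈-blocks-through⁻ {x} {y} {j} j∈ with idx x ∈? B j | idx y ∈? B j | trans (sym (lookup∘tabulate _ j)) ([]=⇒lookup j∈)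
  ... | yes x∈j | yes y∈j | _ = x∈j , y∈j
  ... | yes _ | no _ | ()
  ... | no _ | _ | ()

  blocks-through-bound : ∀ {x y} → x ≢ y → (js : List (Fin b)) → Unique js →
                         All (λ j → x ∈ᴮ j × y ∈ᴮ j) js → length js ≤ 2
  blocks-through-bound {x} {y} x≢y js js! js∋x,y = subst (length js ≤_) (balanced x y x≢y)
    (unique⇒length≤∣p∣ js! (All.map (λ (x∈j , y∈j) → ∈-blocks-through⁺ x∈j y∈j) js∋x,y))

  two-blocks-through : ∀ {x y} → x ≢ y → ∃₂ λ j j′ → j ≢ j′ × (x ∈ᴮ j × y ∈ᴮ j) × (x ∈ᴮ j′ × y ∈ᴮ j′)
  two-blocks-through {x} {y} x≢y =
    let j , j∈ , _ = fresh-member (blocks-through x y) [] (subst (0 <_) (sym (balanced x y x≢y)) (s≤s z≤n))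
        j′ , j′∈ , j′≢j = fresh-member (blocks-through x y) (j ∷ []) (subst (1 <_) (sym (balanced x y x≢y)) (s≤s (s≤s z≤n)))
    in j , j′ , ≢-sym (All.head j′≢j) , ∈-blocks-through⁻ j∈ , ∈-blocks-through⁻ j′∈

  some-block-through : ∀ x → ∃ λ j → x ∈ᴮ j
  some-block-through x = let j , _ , _ , (x∈j , _) , _ = two-blocks-through (x≢x+t x 1≢0) in j , x∈j

  points-bound : ∀ {j} (ys : List Carrier) → Unique ys → All (_∈ᴮ j) ys → length ys ≤ k
  points-bound {j} ys ys! ys⊆j = subst₂ _≤_ (length-map idx ys) (blockSize j)
    (unique⇒length≤∣p∣ (Unique.map⁺ idx-injective ys!) (All.map⁺ ys⊆j))

  fresh-point : ∀ j (ys : List Carrier) → length ys < k → ∃ λ y → y ∈ᴮ j × All (y ≢_) ys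
  fresh-point j ys |ys|<k =
    let i , i∈j , i∉ys = fresh-member (B j) (map idx ys) (subst₂ _<_ (sym (length-map idx ys)) (sym (blockSize j)) |ys|<k)
    in from-enum i , subst (_∈ B j) (sym (idx∘from-enum i)) i∈j
     , All.map (λ i≢idx-y eq → i≢idx-y (trans (sym (idx∘from-enum i)) (cong idx eq))) (All.map⁻ i∉ys)

  record Maps (g : Affine) (i j : Fin b) : Set where
    constructor maps
    field
      to   : ∀ {x} → x ∈ᴮ i → ⟦ g ⟧ x ∈ᴮ j
      from : ∀ {x} → ⟦ g ⟧ x ∈ᴮ j → x ∈ᴮ i

  open Maps public

  fromMapsBlock : ∀ {g i j} → MapsBlock F B (scale g) (shift g) i j → Maps g i j
  fromMapsBlock g-maps = maps (λ {x} → proj₁ (g-maps x)) (λ {x} → proj₂ (g-maps x))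

  image-block : ∀ g i → ∃ λ j → Maps g i j
  image-block g i = let j , g-maps = automorphisms (scale g) (shift g) (scale≢0 g) i in j , fromMapsBlock g-maps

  flag-map : ∀ {x i y j} → x ∈ᴮ i → y ∈ᴮ j → ∃ λ g → ⟦ g ⟧ x ≡ y × Maps g i j
  flag-map x∈i y∈j =
    let a , c , a≢0 , ax+c≡y , g-maps = flag-transitive _ _ _ _ x∈i y∈j
    in mkAffine a c a≢0 , ax+c≡y , fromMapsBlock g-maps

  ∈ᴮ-resp-≡ : ∀ {x y j} → x ≡ y → x ∈ᴮ j → y ∈ᴮ j
  ∈ᴮ-resp-≡ {j = j} = subst (_∈ᴮ j)

  maps-∙ : ∀ {f g i j l} → Maps f i j → Maps g j l → Maps (g ∙ f) i l
  maps-∙ {f} {g} f-maps g-maps = maps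
    (λ {x} x∈i → ∈ᴮ-resp-≡ (sym (⟦∙⟧ g f x)) (to g-maps (to f-maps x∈i)))
    (λ {x} gfx∈l → from f-maps (from g-maps (∈ᴮ-resp-≡ (⟦∙⟧ g f x) gfx∈l)))

  maps-⁻¹ : ∀ {g i j} → Maps g i j → Maps (g ⁻¹) j i
  maps-⁻¹ {g} g-maps = maps
    (λ {x} x∈j → from g-maps (∈ᴮ-resp-≡ (sym (⟦⁻¹⟧-inverseʳ g x)) x∈j))
    (λ {x} g⁻¹x∈i → ∈ᴮ-resp-≡ (⟦⁻¹⟧-inverseʳ g x) (to g-maps g⁻¹x∈i))

  maps-cong : ∀ {g h i j} → (∀ x → ⟦ g ⟧ x ≡ ⟦ h ⟧ x) → Maps g i j → Maps h i j
  maps-cong {g} g≗h g-maps = maps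
    (λ {x} x∈i → ∈ᴮ-resp-≡ (g≗h x) (to g-maps x∈i))
    (λ {x} hx∈j → from g-maps (∈ᴮ-resp-≡ (sym (g≗h x)) hx∈j))

  maps-stable : ∀ {g i j} → ¬ ¬ Maps g i j → Maps g i j
  maps-stable {g} {i} {j} ¬¬g-maps = maps
    (λ x∈i → stable λ gx∉j → ¬¬g-maps λ g-maps → gx∉j (to g-maps x∈i))
    (λ gx∈j → stable λ x∉i → ¬¬g-maps λ g-maps → x∉i (from g-maps gx∈j))
    where
    stable : ∀ {x l} → ¬ ¬ x ∈ᴮ l → x ∈ᴮ l
    stable {x} {l} = decidable-stable (idx x ∈? B l)

  maps-into⇒maps : ∀ {g i} → (∀ {x} → x ∈ᴮ i → ⟦ g ⟧ x ∈ᴮ i) → Maps g i i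
  maps-into⇒maps {g} {i} g-into = maps g-into λ {x} gx∈i →
    let y , y∈i , gy≡gx = injective-preserving⇒onto idx-injective (_∈ᴮ i) ⟦ g ⟧ (⟦⟧-injective g) g-into gx∈i
    in ∈ᴮ-resp-≡ (⟦⟧-injective g gy≡gx) y∈i

  same-points⇒≡ : ∀ {i j} → (∀ {x} → x ∈ᴮ i → x ∈ᴮ j) → (∀ {x} → x ∈ᴮ j → x ∈ᴮ i) → i ≡ j
  same-points⇒≡ {i} {j} i⊆j j⊆i = distinctBlocks i j (⊆-antisym (points⊆ i⊆j) (points⊆ j⊆i))
    where
    points⊆ : ∀ {l l′} → (∀ {x} → x ∈ᴮ l → x ∈ᴮ l′) → B l ⊆ B l′
    points⊆ {l} {l′} l⊆l′ {p} p∈l =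
      subst (_∈ B l′) (idx∘from-enum p) (l⊆l′ (subst (_∈ B l) (sym (idx∘from-enum p)) p∈l))

  trivial-maps⇒≡ : ∀ {g i j} → Trivial g → Maps g i j → i ≡ j
  trivial-maps⇒≡ {g} g-trivial g-maps = same-points⇒≡
    (λ {x} x∈i → ∈ᴮ-resp-≡ (trivial⇒fixes g g-trivial x) (to g-maps x∈i))
    (λ {x} x∈j → from g-maps (∈ᴮ-resp-≡ (sym (trivial⇒fixes g g-trivial x)) x∈j))

  Pair : Set
  Pair = Carrier × Carrier

  PairIn : Fin b → Pair → Set
  PairIn i (u , v) = u ∈ᴮ i × v ∈ᴮ i × u ≢ v

  infix 4 _~[_]_
  _~[_]_ : Pair → Fin b → Pair → Set
  (u , v) ~[ i ] (u′ , v′) = ∃ λ g → Maps g i i × ⟦ g ⟧ u ≡ u′ × ⟦ g ⟧ v ≡ v′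

  ~-sym : ∀ {i u v u′ v′} → (u , v) ~[ i ] (u′ , v′) → (u′ , v′) ~[ i ] (u , v)
  ~-sym {u = u} {v} (g , g-maps , gu≡u′ , gv≡v′) =
    g ⁻¹ , maps-⁻¹ g-maps , trans (cong ⟦ g ⁻¹ ⟧ (sym gu≡u′)) (⟦⁻¹⟧-inverseˡ g u)
                          , trans (cong ⟦ g ⁻¹ ⟧ (sym gv≡v′)) (⟦⁻¹⟧-inverseˡ g v)

  ~-trans : ∀ {i u v u′ v′ u″ v″} → (u , v) ~[ i ] (u′ , v′) → (u′ , v′) ~[ i ] (u″ , v″) → (u , v) ~[ i ] (u″ , v″)
  ~-trans {u = u} {v} (g , g-maps , gu≡u′ , gv≡v′) (h , h-maps , hu′≡u″ , hv′≡v″) =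
    h ∙ g , maps-∙ g-maps h-maps , trans (⟦∙⟧ h g u) (trans (cong ⟦ h ⟧ gu≡u′) hu′≡u″)
                                 , trans (⟦∙⟧ h g v) (trans (cong ⟦ h ⟧ gv≡v′) hv′≡v″)

  private
    Carries : Fin b → Pair → Pair → Fin b → Set
    Carries i (u , v) (u₀ , v₀) j = ∃ λ g → Maps g i j × ⟦ g ⟧ u ≡ u₀ × ⟦ g ⟧ v ≡ v₀

    carry : ∀ {i p u₀ v₀} → PairIn i p → u₀ ≢ v₀ → ∃ λ j → Carries i p (u₀ , v₀) j
    carry {i} (_ , _ , u≢v) u₀≢v₀ =
      let g , gu≡u₀ , gv≡v₀ = two-transitive u≢v u₀≢v₀
          j , g-maps = image-block g i
      in j , g , g-maps , gu≡u₀ , gv≡v₀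

    carried-into : ∀ {i p u₀ v₀ j} → PairIn i p → Carries i p (u₀ , v₀) j → u₀ ∈ᴮ j × v₀ ∈ᴮ j
    carried-into (u∈i , v∈i , _) (g , g-maps , gu≡u₀ , gv≡v₀) =
      ∈ᴮ-resp-≡ gu≡u₀ (to g-maps u∈i) , ∈ᴮ-resp-≡ gv≡v₀ (to g-maps v∈i)

    same-block⇒~ : ∀ {i p p′ p₀ j} → Carries i p p₀ j → Carries i p′ p₀ j → p ~[ i ] p′
    same-block⇒~ {p = u , v} {u′ , v′} (g , g-maps , gu≡u₀ , gv≡v₀) (h , h-maps , hu′≡u₀ , hv′≡v₀) =
      h ⁻¹ ∙ g , maps-∙ g-maps (maps-⁻¹ h-maps)
      , trans (⟦∙⟧ (h ⁻¹) g u) (trans (cong ⟦ h ⁻¹ ⟧ (trans gu≡u₀ (sym hu′≡u₀))) (⟦⁻¹⟧-inverseˡ h u′))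
      , trans (⟦∙⟧ (h ⁻¹) g v) (trans (cong ⟦ h ⁻¹ ⟧ (trans gv≡v₀ (sym hv′≡v₀))) (⟦⁻¹⟧-inverseˡ h v′))

    different-orbits⇒different-blocks : ∀ {i p p′ p₀ j j′} → Carries i p p₀ j → Carries i p′ p₀ j′ →
                                        ¬ p ~[ i ] p′ → j ≢ j′
    different-orbits⇒different-blocks c c′ p≁p′ refl = p≁p′ (same-block⇒~ c c′)

    same-orbit⇒same-block : ∀ {i p p′ u₀ v₀ j j′} → Carries i p (u₀ , v₀) j → Carries i p′ (u₀ , v₀) j′ →
                            p ~[ i ] p′ → u₀ ≢ v₀ → j ≡ j′
    same-orbit⇒same-block {p = u , v} {u′ , v′} {u₀} {v₀}
                          (g , g-maps , gu≡u₀ , gv≡v₀) (g′ , g′-maps , g′u′≡u₀ , g′v′≡v₀)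
                          (h , h-maps , hu≡u′ , hv≡v′) u₀≢v₀ =
      trivial-maps⇒≡ (fix₂⇒trivial φ (fixes u gu≡u₀ hu≡u′ g′u′≡u₀) (fixes v gv≡v₀ hv≡v′ g′v′≡v₀) u₀≢v₀)
                     (maps-∙ (maps-∙ (maps-⁻¹ g-maps) h-maps) g′-maps)
      where
      φ = g′ ∙ h ∙ g ⁻¹
      fixes : ∀ w {w₀ w′} → ⟦ g ⟧ w ≡ w₀ → ⟦ h ⟧ w ≡ w′ → ⟦ g′ ⟧ w′ ≡ w₀ → ⟦ φ ⟧ w₀ ≡ w₀
      fixes w {w₀} {w′} gw≡w₀ hw≡w′ g′w′≡w₀ = begin
        ⟦ g′ ∙ h ∙ g ⁻¹ ⟧ w₀           ≡⟨ ⟦∙∙⟧ g′ h (g ⁻¹) w₀ ⟩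
        ⟦ g′ ⟧ (⟦ h ⟧ (⟦ g ⁻¹ ⟧ w₀))   ≡⟨ cong (⟦ g′ ⟧ ∘ ⟦ h ⟧ ∘ ⟦ g ⁻¹ ⟧) (sym gw≡w₀) ⟩
        ⟦ g′ ⟧ (⟦ h ⟧ (⟦ g ⁻¹ ⟧ (⟦ g ⟧ w)))  ≡⟨ cong (⟦ g′ ⟧ ∘ ⟦ h ⟧) (⟦⁻¹⟧-inverseˡ g w) ⟩
        ⟦ g′ ⟧ (⟦ h ⟧ w)               ≡⟨ cong ⟦ g′ ⟧ hw≡w′ ⟩
        ⟦ g′ ⟧ w′                      ≡⟨ g′w′≡w₀ ⟩
        w₀                             ∎
        where open ≡-Reasoning

    preimage : ∀ {g i j u₀ v₀} → Maps g i j → PairIn j (u₀ , v₀) →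
               PairIn i (⟦ g ⁻¹ ⟧ u₀ , ⟦ g ⁻¹ ⟧ v₀) × Carries i (⟦ g ⁻¹ ⟧ u₀ , ⟦ g ⁻¹ ⟧ v₀) (u₀ , v₀) j
    preimage {g} {u₀ = u₀} {v₀} g-maps (u₀∈j , v₀∈j , u₀≢v₀) =
      (to (maps-⁻¹ g-maps) u₀∈j , to (maps-⁻¹ g-maps) v₀∈j , u₀≢v₀ ∘ ⟦⟧-injective (g ⁻¹))
      , g , g-maps , ⟦⁻¹⟧-inverseʳ g u₀ , ⟦⁻¹⟧-inverseʳ g v₀

  no-three-orbits : ∀ {i p₁ p₂ p₃} → PairIn i p₁ → PairIn i p₂ → PairIn i p₃ →
                    ¬ p₁ ~[ i ] p₂ → ¬ p₁ ~[ i ] p₃ → ¬ p₂ ~[ i ] p₃ → ⊥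
  no-three-orbits P₁@(_ , _ , u≢v) P₂ P₃ p₁≁p₂ p₁≁p₃ p₂≁p₃ =
    let j₁ , c₁ = carry P₁ u≢v
        j₂ , c₂ = carry P₂ u≢v
        j₃ , c₃ = carry P₃ u≢v
        j₁≢j₂ = different-orbits⇒different-blocks c₁ c₂ p₁≁p₂
        j₁≢j₃ = different-orbits⇒different-blocks c₁ c₃ p₁≁p₃
        j₂≢j₃ = different-orbits⇒different-blocks c₂ c₃ p₂≁p₃
    in ≤⇒≯ (blocks-through-bound u≢v (j₁ ∷ j₂ ∷ j₃ ∷ [])
             ((j₁≢j₂ ∷ j₁≢j₃ ∷ []) ∷ (j₂≢j₃ ∷ []) ∷ [] ∷ [])
             (carried-into P₁ c₁ ∷ carried-into P₂ c₂ ∷ carried-into P₃ c₃ ∷ []))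
           ≤-refl

  not-pair-transitive : ∀ {i p₀} → PairIn i p₀ → ¬ (∀ {p} → PairIn i p → ¬ ¬ p ~[ i ] p₀)
  not-pair-transitive {i} {u₀ , v₀} (u₀∈i , _ , u₀≢v₀) all-in-orbit =
    let j , j′ , j≢j′ , (u₀∈j , v₀∈j) , (u₀∈j′ , v₀∈j′) = two-blocks-through u₀≢v₀
        g , _ , g-maps = flag-map u₀∈i u₀∈j
        g′ , _ , g′-maps = flag-map u₀∈i u₀∈j′
        P , c = preimage g-maps (u₀∈j , v₀∈j , u₀≢v₀)
        P′ , c′ = preimage g′-maps (u₀∈j′ , v₀∈j′ , u₀≢v₀)
    in all-in-orbit P λ p~p₀ → all-in-orbit P′ λ p′~p₀ →
         j≢j′ (same-orbit⇒same-block c c′ (~-trans p~p₀ (~-sym p′~p₀)) u₀≢v₀)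

  maps-id : ∀ {i} → Maps id i i
  maps-id = maps (λ {x} → ∈ᴮ-resp-≡ (sym (⟦id⟧ x))) (λ {x} → ∈ᴮ-resp-≡ (⟦id⟧ x))

  Period : Fin b → Carrier → Set
  Period i w = Maps (translation w) i i

  module _ {i : Fin b} where

    period-0 : Period i 0#
    period-0 = maps-id

    period-+ : ∀ {u w} → Period i u → Period i w → Period i (u + w)
    period-+ {u} {w} u-period w-period = maps-cong (λ z → begin
      ⟦ translation w ∙ translation u ⟧ z  ≡⟨ ⟦∙⟧ (translation w) (translation u) z ⟩
      ⟦ translation w ⟧ (⟦ translation u ⟧ z)  ≡⟨ trans (⟦translation⟧ w _) (cong (_+ w) (⟦translation⟧ u z)) ⟩
      z + u + w                             ≡⟨ ≈⇒≡ (+-assoc z u w) ⟩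
      z + (u + w)                           ≡⟨ ⟦translation⟧ (u + w) z ⟨
      ⟦ translation (u + w) ⟧ z             ∎) (maps-∙ u-period w-period)
      where open ≡-Reasoning

    period-neg : ∀ {w} → Period i w → Period i (- w)
    period-neg {w} w-period = maps-cong
      (λ z → ≈⇒≡ (solve 2 (λ z w → con (ℤ.+ 1) :* z :+ :- (con (ℤ.+ 1) :* w) := con (ℤ.+ 1) :* z :+ :- w) ≈-refl z w))
      (maps-⁻¹ w-period)

    period-scale : ∀ {g w} → Maps g i i → Period i w → Period i (scale g * w)
    period-scale {g} {w} g-maps w-period = maps-cong (λ z → begin
      ⟦ g ∙ translation w ∙ g ⁻¹ ⟧ z                 ≡⟨ ⟦∙∙⟧ g (translation w) (g ⁻¹) z ⟩
      ⟦ g ⟧ (⟦ translation w ⟧ (⟦ g ⁻¹ ⟧ z))         ≡⟨ cong ⟦ g ⟧ (⟦translation⟧ w _) ⟩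
      ⟦ g ⟧ (⟦ g ⁻¹ ⟧ z + w)                         ≡⟨ ⟦⟧-+ g _ w ⟩
      ⟦ g ⟧ (⟦ g ⁻¹ ⟧ z) + scale g * w               ≡⟨ cong (_+ scale g * w) (⟦⁻¹⟧-inverseʳ g z) ⟩
      z + scale g * w                               ≡⟨ ⟦translation⟧ (scale g * w) z ⟨
      ⟦ translation (scale g * w) ⟧ z               ∎) (maps-∙ (maps-∙ (maps-⁻¹ g-maps) w-period) g-maps)
      where open ≡-Reasoning

    period-shift : ∀ {w z} → Period i w → z ∈ᴮ i → z + w ∈ᴮ i
    period-shift {w} {z} w-period z∈i = ∈ᴮ-resp-≡ (⟦translation⟧ w z) (to w-period z∈i)

  based-~⇒scale : ∀ {i x s s′} → (x , x + s) ~[ i ] (x , x + s′) → ∃ λ g → Maps g i i × scale g * s ≡ s′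
  based-~⇒scale {x = x} {s} (g , g-maps , gx≡x , g[x+s]≡x+s′) =
    g , g-maps , +-cancelˡ x (trans (sym (fixes⇒⟦⟧-+ g s gx≡x)) g[x+s]≡x+s′)

  module NonzeroPeriod {i x} (x∈i : x ∈ᴮ i) {t} (t-period : Period i t) (t≢0 : t ≢ 0#) where

    private
      x+t-pair : PairIn i (x , x + t)
      x+t-pair = x∈i , period-shift t-period x∈i , x≢x+t x t≢0

      period-from-negation : ∀ {d w} → d + w ≡ 0# → Period i w → Period i d
      period-from-negation d+w≡0 w-period = subst (Period i) (sym (x+y≡0⇒x≡-y d+w≡0)) (period-neg w-period)

    -- For a period w, the pairs (x, x+t), (x, x+d), (x, x+(d+w)) avoid three distinct orbits
    -- only if ψ w is a period, so ψ is an injective self-map of the periods that misses 0.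
    module AperiodicPoint {d} (x+d∈i : x + d ∈ᴮ i) (d-aperiodic : ¬ Period i d) where

      open ≡-Reasoning

      d≢0 : d ≢ 0#
      d≢0 d≡0 = d-aperiodic (subst (Period i) (sym d≡0) period-0)

      d⁻¹ = d ⁻¹⟨ d≢0 ⟩

      ψ : Carrier → Carrier
      ψ w = (d + w) * d⁻¹ * t

      ψ-injective : ∀ {w w′} → ψ w ≡ ψ w′ → w ≡ w′
      ψ-injective = +-cancelˡ d ∘ *-cancelʳ-nonzero (⁻¹-nonzero d≢0) ∘ *-cancelʳ-nonzero t≢0

      d+w≢0 : ∀ {w} → Period i w → d + w ≢ 0#
      d+w≢0 w-period d+w≡0 = d-aperiodic (period-from-negation d+w≡0 w-period)

      ψw≢0 : ∀ {w} → Period i w → ψ w ≢ 0#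
      ψw≢0 w-period = *-nonzero (*-nonzero (d+w≢0 w-period) (⁻¹-nonzero d≢0)) t≢0

      ψ-preserves : ∀ {w} → Period i w → Period i (ψ w)
      ψ-preserves {w} w-period = maps-stable λ ψw-aperiodic →
        no-three-orbits x+t-pair x+d-pair x+d+w-pair x+t≁x+d x+t≁x+d+w (x+d≁x+d+w ψw-aperiodic)
        where
        x+d-pair : PairIn i (x , x + d)
        x+d-pair = x∈i , x+d∈i , x≢x+t x d≢0
        x+d+w-pair : PairIn i (x , x + (d + w))
        x+d+w-pair = x∈i , ∈ᴮ-resp-≡ (≈⇒≡ (+-assoc x d w)) (period-shift w-period x+d∈i) , x≢x+t x (d+w≢0 w-period)
        x+t≁x+d : ¬ (x , x + t) ~[ i ] (x , x + d)
        x+t≁x+d r = let g , g-maps , at≡d = based-~⇒scale r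
                    in d-aperiodic (subst (Period i) at≡d (period-scale g-maps t-period))
        x+t≁x+d+w : ¬ (x , x + t) ~[ i ] (x , x + (d + w))
        x+t≁x+d+w r = let g , g-maps , at≡d+w = based-~⇒scale r
                      in d-aperiodic (subst (Period i)
                           (trans (cong (_- w) at≡d+w) (≈⇒≡ (solve 2 (λ d w → d :+ w :- w := d) ≈-refl d w)))
                           (period-+ (period-scale g-maps t-period) (period-neg w-period)))
        x+d≁x+d+w : ¬ Period i (ψ w) → ¬ (x , x + d) ~[ i ] (x , x + (d + w))
        x+d≁x+d+w ψw-aperiodic r = let g , g-maps , ad≡d+w = based-~⇒scale r
                                   in ψw-aperiodic (subst (Period i) (cong (_* t) (begin
                                        scale g               ≡⟨ x*t*t⁻¹≡x (scale g) d≢0 ⟨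
                                        scale g * d * d⁻¹     ≡⟨ cong (_* d⁻¹) ad≡d+w ⟩
                                        (d + w) * d⁻¹         ∎)) (period-scale g-maps t-period))

    aperiodic-point⇒⊥ : ∀ {d} → x + d ∈ᴮ i → ¬ Period i d → ⊥
    aperiodic-point⇒⊥ x+d∈i d-aperiodic =
      let open AperiodicPoint x+d∈i d-aperiodic
          w , w-period , ψw≡0 = injective-preserving⇒onto idx-injective (Period i) ψ ψ-injective ψ-preserves period-0
      in ψw≢0 w-period ψw≡0

    -- Here block i is x + (periods), so dilations about x preserving the periods stabilise it,
    -- which puts every pair of the block in the orbit of (x, x+t).
    module PeriodicBlock (all-periodic : ∀ {y} → y ∈ᴮ i → Period i (y - x)) where

      open ≡-Reasoning

      dilation-maps : ∀ {a} (a≢0 : a ≢ 0#) → (∀ {s} → Period i s → Period i (a * s)) → Maps (dilation x a a≢0) i i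
      dilation-maps {a} a≢0 a-preserves = maps-into⇒maps λ {z} z∈i →
        ∈ᴮ-resp-≡ (sym (⟦dilation⟧ x a≢0 z)) (period-shift (a-preserves (all-periodic z∈i)) x∈i)

      dilation-~ : ∀ {a} (a≢0 : a ≢ 0#) → (∀ {s} → Period i s → Period i (a * s)) →
                   ∀ s → (x , x + s) ~[ i ] (x , x + a * s)
      dilation-~ {a} a≢0 a-preserves s =
        dilation x a a≢0 , dilation-maps a≢0 a-preserves
        , trans (⟦dilation⟧ x a≢0 x) (≈⇒≡ (solve 2 (λ x a → x :+ a :* (x :- x) := x) ≈-refl x a))
        , trans (⟦dilation⟧ x a≢0 (x + s)) (≈⇒≡ (solve 3 (λ x a s → x :+ a :* (x :+ s :- x) := x :+ a :* s) ≈-refl x a s))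

      shrink : ∀ {σ σ′} → σ′ ≢ 0# → (x , x + σ) ~[ i ] (x , x + (σ + σ′)) → (x , x + σ) ~[ i ] (x , x + σ′)
      shrink {σ} {σ′} σ′≢0 r =
        let g , g-maps , aσ≡σ+σ′ = based-~⇒scale r
            [a-1]σ≡σ′ : (scale g - 1#) * σ ≡ σ′
            [a-1]σ≡σ′ = begin
              (scale g - 1#) * σ     ≡⟨ ≈⇒≡ (solve 2 (λ a σ → (a :- con (ℤ.+ 1)) :* σ := a :* σ :- σ) ≈-refl (scale g) σ) ⟩
              scale g * σ - σ        ≡⟨ cong (_- σ) aσ≡σ+σ′ ⟩
              σ + σ′ - σ             ≡⟨ ≈⇒≡ (solve 2 (λ σ σ′ → σ :+ σ′ :- σ := σ′) ≈-refl σ σ′) ⟩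
              σ′                     ∎
            a-1≢0 : scale g - 1# ≢ 0#
            a-1≢0 a-1≡0 = σ′≢0 (trans (sym [a-1]σ≡σ′) (trans (cong (_* σ) a-1≡0) (≈⇒≡ (zeroˡ σ))))
            a-1-preserves : ∀ {s} → Period i s → Period i ((scale g - 1#) * s)
            a-1-preserves {s} s-period = subst (Period i)
              (≈⇒≡ (solve 2 (λ a s → a :* s :- s := (a :- con (ℤ.+ 1)) :* s) ≈-refl (scale g) s))
              (period-+ (period-scale g-maps s-period) (period-neg s-period))
        in subst (λ e → (x , x + σ) ~[ i ] (x , x + e)) [a-1]σ≡σ′ (dilation-~ a-1≢0 a-1-preserves σ)

      in-orbit-of-x+t : ∀ {p} → PairIn i p → ¬ ¬ p ~[ i ] (x , x + t)
      in-orbit-of-x+t {u , v} (u∈i , v∈i , u≢v) p≁x+t = no-three-orbits x+t-pair x+s-pair x+t+s-pair x+t≁x+s x+t≁x+t+s x+s≁x+t+s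
        where
        s = v - u
        s≢0 = x≢y⇒x-y≢0 (u≢v ∘ sym)
        s-period : Period i s
        s-period = subst (Period i) (≈⇒≡ (solve 3 (λ u v x → v :- x :+ :- (u :- x) := v :- u) ≈-refl u v x))
                     (period-+ (all-periodic v∈i) (period-neg (all-periodic u∈i)))
        p~x+s : (u , v) ~[ i ] (x , x + s)
        p~x+s = translation (x - u)
              , subst (Period i) (≈⇒≡ (solve 2 (λ u x → :- (u :- x) := x :- u) ≈-refl u x)) (period-neg (all-periodic u∈i))
              , trans (⟦translation⟧ _ u) (≈⇒≡ (solve 2 (λ u x → u :+ (x :- u) := x) ≈-refl u x))
              , trans (⟦translation⟧ _ v) (≈⇒≡ (solve 3 (λ u v x → v :+ (x :- u) := x :+ (v :- u)) ≈-refl u v x))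
        x+t≁x+s : ¬ (x , x + t) ~[ i ] (x , x + s)
        x+t≁x+s r = p≁x+t (~-trans p~x+s (~-sym r))
        t+s≢0 : t + s ≢ 0#
        t+s≢0 t+s≡0 = x+t≁x+s (subst (λ e → (x , x + t) ~[ i ] (x , x + e)) -1*t≡s
                                 (dilation-~ -1≢0 (λ s-period → subst (Period i) (sym (-1*x≡-x _)) (period-neg s-period)) t))
          where
          -1*t≡s : - 1# * t ≡ s
          -1*t≡s = trans (-1*x≡-x t) (sym (x+y≡0⇒x≡-y (trans (≈⇒≡ (+-comm s t)) t+s≡0)))
        x+s-pair : PairIn i (x , x + s)
        x+s-pair = x∈i , period-shift s-period x∈i , x≢x+t x s≢0
        x+t+s-pair : PairIn i (x , x + (t + s))
        x+t+s-pair = x∈i , period-shift (period-+ t-period s-period) x∈i , x≢x+t x t+s≢0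
        x+t≁x+t+s : ¬ (x , x + t) ~[ i ] (x , x + (t + s))
        x+t≁x+t+s r = x+t≁x+s (shrink s≢0 r)
        x+s≁x+t+s : ¬ (x , x + s) ~[ i ] (x , x + (t + s))
        x+s≁x+t+s r = x+t≁x+s (~-sym (shrink t≢0 (subst (λ e → (x , x + s) ~[ i ] (x , x + e)) (≈⇒≡ (+-comm t s)) r)))

    periodic-block⇒⊥ : (∀ {y} → y ∈ᴮ i → Period i (y - x)) → ⊥
    periodic-block⇒⊥ all-periodic = not-pair-transitive x+t-pair (PeriodicBlock.in-orbit-of-x+t all-periodic)

  period≡0 : ∀ {i x w} → x ∈ᴮ i → Period i w → w ≡ 0#
  period≡0 {i} {x} {w} x∈i w-period with w ≟ 0#
  ... | yes w≡0 = w≡0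
  ... | no w≢0 = ⊥-elim (periodic-block⇒⊥ λ {y} y∈i → maps-stable (aperiodic-point⇒⊥ (∈ᴮ-resp-≡ (x+[y-x]≡y y) y∈i)))
    where
    open NonzeroPeriod x∈i w-period w≢0
    x+[y-x]≡y : ∀ y → y ≡ x + (y - x)
    x+[y-x]≡y y = ≈⇒≡ (solve 2 (λ x y → y := x :+ (y :- x)) ≈-refl x y)

  module Stabiliser {i x} (x∈i : x ∈ᴮ i) where

    same-scale⇒same-shift : ∀ {g h} → Maps g i i → Maps h i i → scale g ≡ scale h → shift g ≡ shift h
    same-scale⇒same-shift {g} {h} g-maps h-maps ag≡ah =
      x-y≡0⇒x≡y (period≡0 x∈i (maps-cong g∙h⁻¹≗translation (maps-∙ (maps-⁻¹ h-maps) g-maps)))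
      where
      open ≡-Reasoning
      g∙h⁻¹≗translation : ∀ z → ⟦ g ∙ h ⁻¹ ⟧ z ≡ ⟦ translation (shift g - shift h) ⟧ z
      g∙h⁻¹≗translation z = begin
        ⟦ g ∙ h ⁻¹ ⟧ z                              ≡⟨ ⟦∙⟧ g (h ⁻¹) z ⟩
        scale g * ⟦ h ⁻¹ ⟧ z + shift g             ≡⟨ cong (λ a → a * ⟦ h ⁻¹ ⟧ z + shift g) ag≡ah ⟩
        scale h * ⟦ h ⁻¹ ⟧ z + shift g             ≡⟨ ≈⇒≡ (solve 4 (λ a y c c′ → a :* y :+ c′ := a :* y :+ c :+ (c′ :- c))
                                                            ≈-refl (scale h) (⟦ h ⁻¹ ⟧ z) (shift h) (shift g)) ⟩
        ⟦ h ⟧ (⟦ h ⁻¹ ⟧ z) + (shift g - shift h)   ≡⟨ cong (_+ (shift g - shift h)) (⟦⁻¹⟧-inverseʳ h z) ⟩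
        z + (shift g - shift h)                    ≡⟨ ⟦translation⟧ _ z ⟨
        ⟦ translation (shift g - shift h) ⟧ z      ∎

    commute : ∀ {g h} → Maps g i i → Maps h i i → ∀ z → ⟦ g ⟧ (⟦ h ⟧ z) ≡ ⟦ h ⟧ (⟦ g ⟧ z)
    commute {g} {h} g-maps h-maps z = begin
      ⟦ g ⟧ (⟦ h ⟧ z)                        ≡⟨ ⟦∙⟧ g h z ⟨
      scale (g ∙ h) * z + shift (g ∙ h)      ≡⟨ cong₂ (λ a c → a * z + c) gh≡hg
                                                  (same-scale⇒same-shift (maps-∙ h-maps g-maps) (maps-∙ g-maps h-maps) gh≡hg) ⟩
      scale (h ∙ g) * z + shift (h ∙ g)      ≡⟨ ⟦∙⟧ h g z ⟩
      ⟦ h ⟧ (⟦ g ⟧ z)                        ∎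
      where
      open ≡-Reasoning
      gh≡hg : scale g * scale h ≡ scale h * scale g
      gh≡hg = ≈⇒≡ (*-comm (scale g) (scale h))

    fixed-point⇒trivial : 1 < k → ∀ {g z} → Maps g i i → z ∈ᴮ i → ⟦ g ⟧ z ≡ z → Trivial g
    fixed-point⇒trivial 1<k {g} {z} g-maps z∈i gz≡z =
      let y , y∈i , y≢[z] = fresh-point i (z ∷ []) 1<k
          h , hz≡y , h-maps = flag-map z∈i y∈i
          gy≡y = begin
            ⟦ g ⟧ y              ≡⟨ cong ⟦ g ⟧ hz≡y ⟨
            ⟦ g ⟧ (⟦ h ⟧ z)      ≡⟨ commute g-maps h-maps z ⟩
            ⟦ h ⟧ (⟦ g ⟧ z)      ≡⟨ cong ⟦ h ⟧ gz≡z ⟩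
            ⟦ h ⟧ z              ≡⟨ hz≡y ⟩
            y                    ∎
      in fix₂⇒trivial g gz≡z gy≡y (All.head y≢[z] ∘ sym)
      where open ≡-Reasoning

  IsTriple : Fin b → Carrier → Carrier → Carrier → Set
  IsTriple j ζ a c = ∀ w → (w ∈ᴮ j → InTriple F ζ a c w) × (InTriple F ζ a c w → w ∈ᴮ j)

  triple-image : ∀ {h i j ζ a c} → Maps h i j → IsTriple i ζ a c → IsTriple j ζ (scale h * a) (⟦ h ⟧ c)
  triple-image {h} h-maps i-triple w =
      (λ w∈j → subst (InTriple F _ _ _) (⟦⁻¹⟧-inverseʳ h w)
                 (InTriple-image h (proj₁ (i-triple _) (to (maps-⁻¹ h-maps) w∈j))))
    , (λ w∈triple → ∈ᴮ-resp-≡ (⟦⁻¹⟧-inverseʳ h w) (to h-maps (proj₂ (i-triple _) (InTriple-preimage h w∈triple))))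

  module TripleStructure (2<k : 2 < k) {i x} (x∈i : x ∈ᴮ i) where

    open Stabiliser x∈i
    open ≡-Reasoning

    private
      1<k : 1 < k
      1<k = <-trans (s≤s (s≤s z≤n)) 2<k

      based-~⇒≡ : ∀ {y y′} → (x , y) ~[ i ] (x , y′) → y ≡ y′
      based-~⇒≡ {y} (g , g-maps , gx≡x , gy≡y′) =
        trans (sym (trivial⇒fixes g (fixed-point⇒trivial 1<k g-maps x∈i gx≡x) y)) gy≡y′

    k≤3 : k ≤ 3
    k≤3 with k ≤? 3
    ... | yes k≤3 = k≤3
    ... | no k≰3 =
      let 3<k = ≰⇒> k≰3
          y₁ , y₁∈i , y₁∉ = fresh-point i (x ∷ []) 1<k
          y₂ , y₂∈i , y₂∉ = fresh-point i (x ∷ y₁ ∷ []) 2<k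
          y₃ , y₃∈i , y₃∉ = fresh-point i (x ∷ y₁ ∷ y₂ ∷ []) 3<k
          pair : ∀ {y} → y ∈ᴮ i → y ≢ x → PairIn i (x , y)
          pair y∈i y≢x = x∈i , y∈i , y≢x ∘ sym
      in ⊥-elim (no-three-orbits (pair y₁∈i (All.head y₁∉)) (pair y₂∈i (All.head y₂∉)) (pair y₃∈i (All.head y₃∉))
                  (All.head (All.tail y₂∉) ∘ sym ∘ based-~⇒≡)
                  (All.head (All.tail y₃∉) ∘ sym ∘ based-~⇒≡)
                  (All.head (All.tail (All.tail y₃∉)) ∘ sym ∘ based-~⇒≡))

    private
      y-fresh = fresh-point i (x ∷ []) 1<k
      y = proj₁ y-fresh
      y∈i = proj₁ (proj₂ y-fresh)
      x≢y : x ≢ y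
      x≢y = All.head (proj₂ (proj₂ y-fresh)) ∘ sym

      z-fresh = fresh-point i (x ∷ y ∷ []) 2<k
      z = proj₁ z-fresh
      z∈i = proj₁ (proj₂ z-fresh)
      x≢z : x ≢ z
      x≢z = All.head (proj₂ (proj₂ z-fresh)) ∘ sym
      y≢z : y ≢ z
      y≢z = All.head (All.tail (proj₂ (proj₂ z-fresh))) ∘ sym

      block-points : ∀ {w} → w ∈ᴮ i → w ≡ x ⊎ w ≡ y ⊎ w ≡ z
      block-points {w} w∈i with w ≟ x | w ≟ y | w ≟ z
      ... | yes w≡x | _ | _ = inj₁ w≡x
      ... | no _ | yes w≡y | _ = inj₂ (inj₁ w≡y)
      ... | no _ | no _ | yes w≡z = inj₂ (inj₂ w≡z)
      ... | no w≢x | no w≢y | no w≢z = ⊥-elim (≤⇒≯ (≤-trans (points-bound (x ∷ y ∷ z ∷ w ∷ [])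
              ((x≢y ∷ x≢z ∷ (w≢x ∘ sym) ∷ []) ∷ (y≢z ∷ (w≢y ∘ sym) ∷ []) ∷ ((w≢z ∘ sym) ∷ []) ∷ [] ∷ [])
              (x∈i ∷ y∈i ∷ z∈i ∷ w∈i ∷ [])) k≤3) ≤-refl)

      g-flag = flag-map x∈i y∈i
      g = proj₁ g-flag
      gx≡y : ⟦ g ⟧ x ≡ y
      gx≡y = proj₁ (proj₂ g-flag)
      g-maps : Maps g i i
      g-maps = proj₂ (proj₂ g-flag)

      g-fixed-point-free : ∀ {w} → w ∈ᴮ i → ⟦ g ⟧ w ≢ w
      g-fixed-point-free w∈i gw≡w = x≢y (trans (sym (trivial⇒fixes g (fixed-point⇒trivial 1<k g-maps w∈i gw≡w) x)) gx≡y)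

      gz≡x : ⟦ g ⟧ z ≡ x
      gz≡x with block-points (to g-maps z∈i)
      ... | inj₁ gz≡x = gz≡x
      ... | inj₂ (inj₁ gz≡y) = ⊥-elim (x≢z (⟦⟧-injective g (trans gx≡y (sym gz≡y))))
      ... | inj₂ (inj₂ gz≡z) = ⊥-elim (g-fixed-point-free z∈i gz≡z)

      gy≡z : ⟦ g ⟧ y ≡ z
      gy≡z with block-points (to g-maps y∈i)
      ... | inj₁ gy≡x = ⊥-elim (y≢z (⟦⟧-injective g (trans gy≡x (sym gz≡x))))
      ... | inj₂ (inj₁ gy≡y) = ⊥-elim (g-fixed-point-free y∈i gy≡y)
      ... | inj₂ (inj₂ gy≡z) = gy≡z

    ζ : Carrier
    ζ = scale g

    ζ≢1 : ζ ≢ 1#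
    ζ≢1 ζ≡1 = g-fixed-point-free x∈i (trivial⇒fixes g (ζ≡1 , same-scale⇒same-shift g-maps maps-id ζ≡1) x)

    ζ-order3 : HasOrder3 F ζ
    ζ-order3 = ζ≢1 , proj₁ (fixed-point⇒trivial 1<k (maps-∙ (maps-∙ g-maps g-maps) g-maps) x∈i (begin
      ⟦ g ∙ g ∙ g ⟧ x            ≡⟨ ⟦∙∙⟧ g g g x ⟩
      ⟦ g ⟧ (⟦ g ⟧ (⟦ g ⟧ x))    ≡⟨ cong (⟦ g ⟧ ∘ ⟦ g ⟧) gx≡y ⟩
      ⟦ g ⟧ (⟦ g ⟧ y)            ≡⟨ cong ⟦ g ⟧ gy≡z ⟩
      ⟦ g ⟧ z                    ≡⟨ gz≡x ⟩
      x                          ∎))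

    private
      centre = fixed-point g ζ≢1
      f = proj₁ centre
      gf≡f = proj₂ centre

    radius : Carrier
    radius = x - f

    radius≢0 : radius ≢ 0#
    radius≢0 x-f≡0 = g-fixed-point-free x∈i (subst (λ w → ⟦ g ⟧ w ≡ w) (sym (x-y≡0⇒x≡y x-f≡0)) gf≡f)

    block-triple : IsTriple i ζ radius f
    block-triple w = to-triple , from-triple
      where
      x≡f+r : x ≡ f + radius
      x≡f+r = ≈⇒≡ (solve 2 (λ x f → x := f :+ (x :- f)) ≈-refl x f)
      y≡f+rζ : y ≡ f + radius * ζ
      y≡f+rζ = begin
        y                        ≡⟨ gx≡y ⟨
        ⟦ g ⟧ x                  ≡⟨ cong ⟦ g ⟧ x≡f+r ⟩
        ⟦ g ⟧ (f + radius)       ≡⟨ fixes⇒⟦⟧-+ g radius gf≡f ⟩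
        f + ζ * radius           ≡⟨ cong (f +_) (≈⇒≡ (*-comm ζ radius)) ⟩
        f + radius * ζ           ∎
      z≡f+rζ² : z ≡ f + radius * (ζ * ζ)
      z≡f+rζ² = begin
        z                        ≡⟨ gy≡z ⟨
        ⟦ g ⟧ y                  ≡⟨ cong ⟦ g ⟧ y≡f+rζ ⟩
        ⟦ g ⟧ (f + radius * ζ)   ≡⟨ fixes⇒⟦⟧-+ g (radius * ζ) gf≡f ⟩
        f + ζ * (radius * ζ)     ≡⟨ cong (f +_) (≈⇒≡ (solve 2 (λ ζ r → ζ :* (r :* ζ) := r :* (ζ :* ζ)) ≈-refl ζ radius)) ⟩
        f + radius * (ζ * ζ)     ∎

      to-triple : w ∈ᴮ i → InTriple F ζ radius f w
      to-triple w∈i =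
        Sum.map (flip trans x≡f+r) (Sum.map (flip trans y≡f+rζ) (flip trans z≡f+rζ²)) (block-points w∈i)

      from-triple : InTriple F ζ radius f w → w ∈ᴮ i
      from-triple (inj₁ w≡f+r) = ∈ᴮ-resp-≡ (trans x≡f+r (sym w≡f+r)) x∈i
      from-triple (inj₂ (inj₁ w≡f+rζ)) = ∈ᴮ-resp-≡ (trans y≡f+rζ (sym w≡f+rζ)) y∈i
      from-triple (inj₂ (inj₂ w≡f+rζ²)) = ∈ᴮ-resp-≡ (trans z≡f+rζ² (sym w≡f+rζ²)) z∈i

    every-block-triple : ∀ j → ∃₂ λ a c → a ≢ 0# × IsTriple j ζ a c
    every-block-triple j =
      let w , w∈j , _ = fresh-point j [] (<-trans (s≤s z≤n) 1<k)
          h , _ , h-maps = flag-map x∈i w∈j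
      in scale h * radius , ⟦ h ⟧ f , *-nonzero (scale≢0 h) radius≢0 , triple-image h-maps block-triple

    every-triple-block : ∀ a c → a ≢ 0# → ∃ λ j → IsTriple j ζ a c
    every-triple-block a c a≢0 =
      let s = a * radius ⁻¹⟨ radius≢0 ⟩
          h = mkAffine s (c - s * f) (*-nonzero a≢0 (⁻¹-nonzero radius≢0))
          j , h-maps = image-block h i
      in j , subst₂ (IsTriple j ζ) (x*t⁻¹*t≡x a radius≢0) (≈⇒≡ (solve 2 (λ sf c → sf :+ (c :- sf) := c) ≈-refl (s * f) c))
                    (triple-image h-maps block-triple)

lemma4p2 : (p d : ℕ) → Prime p → (F : FiniteField (p ^ d))
  → (b k r : ℕ) → (B : Fin b → Subset (p ^ d))
  → Is2Design F k 2 B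
  → 2 < k → k < p ^ d
  → 2 ∣ r → (∀ x → replication F B x ≡ r)
  → AGL1Automorphisms F B
  → AGL1FlagTransitive F B
  → ((p ^ d) % 3 ≡ 1)
    × (k ≡ 3)
    × Σ (FiniteField.Carrier F) (λ ζ → HasOrder3 F ζ
        × (∀ i → Σ (FiniteField.Carrier F) λ a → Σ (FiniteField.Carrier F) λ c
               → ¬ (a ≡ FiniteField.0# F)
               × (∀ x → (_∈B_ F x (B i) → InTriple F ζ a c x)
                      × (InTriple F ζ a c x → _∈B_ F x (B i))))
        × (∀ a c → ¬ (a ≡ FiniteField.0# F) → ∃ λ i
               → ∀ x → (_∈B_ F x (B i) → InTriple F ζ a c x)
                      × (InTriple F ζ a c x → _∈B_ F x (B i))))
lemma4p2 p d _ F b k r B design 2<k _ _ _ automorphisms flag-transitive =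
  order3⇒q%3≡1 ζ-order3 , ≤-antisym k≤3 2<k , ζ , ζ-order3 , every-block-triple , every-triple-block
  where
  open FiniteFieldProperties F using (order3⇒q%3≡1)
  open Design F B design automorphisms flag-transitive
  open TripleStructure 2<k (proj₂ (some-block-through (FiniteField.0# F)))
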